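{- For each edit type $\mathrm{edit} \in \{\mathrm{sub}, \mathrm{ins}, \mathrm{del}\}$, $\mathrm{AS}_{\mathrm{edit}}(z_{\mathrm{SSsr}}, n) = O(n^{2/3})$ and $\mathrm{AS}_{\mathrm{edit}}(z_{\mathrm{SS}}, n) = O(n^{2/3})$.
   Context: Strings are finite sequences over an alphabet; $T[i..j]$ is the substring from position $i$ to $j$. In an LZ-style factorization $T=f_1\cdots f_z$ each phrase is either a single fresh character (not occurring earlier in $T$) or a copy of an earlier-occurring substring. Let $s = |f_1\cdots f_{k-1}|+1$ be the start of phrase $f_k$. In the overlapping LZSS factorization, if $T[s]$ does not occur in $T[1..s-1]$ then $f_k=T[s]$, otherwise $f_k$ is the longest prefix of $T[s..n]$ with an occurrence starting at a position $<s$ (overlap with $f_k$ allowed); $z_{\mathrm{SSsr}}(T)$ is its number of phrases. In the non-overlapping LZSS factorization, $f_k$ is a fresh character if $T[s]$ does not occur in $T[1..s-1]$, and otherwise is the longest prefix of $T[s..n]$ that occurs in $T[1..s-1]$; $z_{\mathrm{SS}}(T)$ is its number of phrases. For a measure $c$, $\mathrm{AS}_{\mathrm{edit}}(c,n) = \max\{c(T')-c(T)\}$ over all strings $T$ of length $n$ and all $T'$ obtained from $T$ by a single edit of the given type (substitution, insertion or deletion of one character). -}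

module Defs where

open import Data.Bool using (Bool; true; false; if_then_else_; _∧_)
open import Data.Nat using (ℕ; zero; suc; _+_; _∸_; _≤ᵇ_; _⊔_; _<_; _≤_)
open import Data.List using (List; []; _∷_; take; drop; length; upTo; _++_)
open import Data.Bool.ListAction using (any)
open import Data.List.Properties using (≡-dec)
open import Relation.Nullary.Decidable using (⌊_⌋)
open import Relation.Binary.Definitions using (DecidableEquality)
open import Relation.Binary.PropositionalEquality using (_≡_)

module _ {A : Set} (_≟_ : DecidableEquality A) where

  _==_ : List A → List A → Bool
  u == v = ⌊ ≡-dec _≟_ u v ⌋

  -- Overlapping: T[s .. s+ℓ-1] has an occurrence starting at some p < s
  -- (the occurrence may overlap position s and beyond).
  occOv : List A → ℕ → ℕ → Bool
  occOv T s ℓ = any (λ p → take ℓ (drop p T) == take ℓ (drop s T)) (upTo s)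

  occNo : List A → ℕ → ℕ → Bool
  occNo T s ℓ = any (λ p → (p + ℓ ≤ᵇ s) ∧ (take ℓ (drop p T) == take ℓ (drop s T))) (upTo s)

  longest : (ℕ → Bool) → ℕ → ℕ
  longest f zero = 0
  longest f (suc m) = if f (suc m) then suc m else longest f m

  -- length of the phrase starting at s: the longest prefix of T[s..] with an
  -- earlier occurrence; if T[s] does not occur earlier (no such prefix of
  -- length ≥ 1 exists) the phrase is the single fresh character T[s].
  phraseLen : (List A → ℕ → ℕ → Bool) → List A → ℕ → ℕ
  phraseLen occ T s = 1 ⊔ longest (occ T s) (length T ∸ s)

  countPhrases : (List A → ℕ → ℕ → Bool) → List A → ℕ → ℕ → ℕ
  countPhrases occ T zero s = 0
  countPhrases occ T (suc fuel) s =
    if length T ≤ᵇ s then 0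
    else suc (countPhrases occ T fuel (s + phraseLen occ T s))

  -- every phrase has length ≥ 1, so fuel = length T suffices
  zSSsr : List A → ℕ
  zSSsr T = countPhrases occOv T (length T) 0

  zSS : List A → ℕ
  zSS T = countPhrases occNo T (length T) 0

data EditKind : Set where
  sub ins del : EditKind

data IsEdit {A : Set} : EditKind → List A → List A → Set where
  substitution : ∀ (T : List A) (i : ℕ) (c : A) → i < length T →
                 IsEdit sub T (take i T ++ c ∷ drop (suc i) T)
  insertion    : ∀ (T : List A) (i : ℕ) (c : A) → i ≤ length T →
                 IsEdit ins T (take i T ++ c ∷ drop i T)
  deletion     : ∀ (T : List A) (i : ℕ) → i < length T →
                 IsEdit del T (take i T ++ drop (suc i) T)

-- The greedy factorisations are optimal among all factorisations into letters and copies
-- of earlier factors, so it suffices to turn the greedy factorisation of T into some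
-- factorisation of T' with few extra phrases. Phrases before the edited position i
-- survive and the phrase over i is cut into at most five pieces. A phrase after the edit
-- survives unless all of its sources straddle i; such a bad phrase is cut into three
-- pieces around the letter corresponding to i in its source. Bad phrases are disjoint,
-- so if n ≤ L³ at most L² of them have length ≥ L. Two bad phrases of equal length whose
-- sources contain i at the same offset share their source, so the earlier one would be a
-- source of the later one avoiding i; hence short bad phrases have distinct pairs
-- (length, offset) and there are at most L² of them. With L ≈ n^(1/3) the number of
-- phrases grows by O(n^(2/3)).

module Submission where

open import Defs
open import Data.Nat using (ℕ; _∸_; _*_; _^_; _≤_)
open import Data.List using (List; length)
open import Data.Product using (_×_; ∃-syntax)
open import Relation.Binary.Definitions using (DecidableEquality)
open import Relation.Binary.PropositionalEquality using (_≡_)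

open import Data.Bool using (Bool; true; false; T)
open import Data.Bool.ListAction using (any)
open import Data.Bool.Properties using (T-∧)
open import Data.Fin using (Fin; zero; suc; fromℕ<)
import Data.Fin.Properties as Fin
open import Data.List using ([]; _∷_; _++_; take; drop; upTo; lookup)
open import Data.List.Membership.Propositional using (find; lose)
open import Data.List.Membership.Propositional.Properties using (∈-upTo⁺; ∈-upTo⁻; ∈-lookup)
open import Data.List.Properties using (length-++; length-take; length-drop)
open import Data.List.Relation.Unary.All as All using (All; []; _∷_)
open import Data.List.Relation.Unary.AllPairs using (AllPairs; []; _∷_)
open import Data.List.Relation.Unary.Any.Properties using (any⁺; any⁻)
open import Data.Maybe using (Maybe; just; nothing)
open import Data.Maybe.Properties using () renaming (≡-dec to ≡-dec-Maybe)
open import Data.Nat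
open import Data.Nat.DivMod using (_%_; [m+kn]%n≡m%n; m<n⇒m%n≡m)
open import Data.Nat.Properties renaming (_≟_ to _≟ℕ_)
open import Data.Nat.Tactic.RingSolver using (solve-∀)
open import Data.Product using (Σ; _,_)
open import Data.Sum as Sum using (_⊎_; inj₁; inj₂)
open import Data.Unit using (⊤; tt)
open import Function using (_∘_; Equivalence)
open import Relation.Binary.PropositionalEquality
open import Relation.Nullary using (¬_; Dec; yes; no; contradiction; _×-dec_; _⊎-dec_)
open import Relation.Nullary.Decidable using (map′; toWitness; fromWitness)

private variable
  A : Set

infixl 9 _!?_

_!?_ : List A → ℕ → Maybe A
[]       !? _     = nothing
(x ∷ xs) !? zero  = just x
(x ∷ xs) !? suc j = xs !? j

drop-!? : ∀ k (xs : List A) j → drop k xs !? j ≡ xs !? (k + j)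
drop-!? zero    xs       j = refl
drop-!? (suc k) []       j = refl
drop-!? (suc k) (x ∷ xs) j = drop-!? k xs j

take-!? : ∀ k (xs : List A) {j} → j < k → take k xs !? j ≡ xs !? j
take-!? (suc k) []       _         = refl
take-!? (suc k) (x ∷ xs) {zero}  _ = refl
take-!? (suc k) (x ∷ xs) {suc j} j<k = take-!? k xs (s<s⁻¹ j<k)

++-!?ˡ : ∀ (xs ys : List A) {j} → j < length xs → (xs ++ ys) !? j ≡ xs !? j
++-!?ˡ (x ∷ xs) ys {zero}  _   = refl
++-!?ˡ (x ∷ xs) ys {suc j} j<n = ++-!?ˡ xs ys (s<s⁻¹ j<n)

++-!?ʳ : ∀ (xs ys : List A) j → (xs ++ ys) !? (length xs + j) ≡ ys !? j
++-!?ʳ []       ys j = refl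
++-!?ʳ (x ∷ xs) ys j = ++-!?ʳ xs ys j

take≡take⇒!?≡ : ∀ ℓ (xs ys : List A) → take ℓ xs ≡ take ℓ ys → ∀ {j} → j < ℓ → xs !? j ≡ ys !? j
take≡take⇒!?≡ ℓ xs ys eq {j} j<ℓ = begin
  xs !? j           ≡⟨ take-!? ℓ xs j<ℓ ⟨
  take ℓ xs !? j    ≡⟨ cong (_!? j) eq ⟩
  take ℓ ys !? j    ≡⟨ take-!? ℓ ys j<ℓ ⟩
  ys !? j           ∎
  where open ≡-Reasoning

!?≡⇒take≡take : ∀ ℓ (xs ys : List A) → (∀ {j} → j < ℓ → xs !? j ≡ ys !? j) → take ℓ xs ≡ take ℓ ys
!?≡⇒take≡take zero    xs       ys       _  = refl
!?≡⇒take≡take (suc ℓ) []       []       _  = refl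
!?≡⇒take≡take (suc ℓ) []       (y ∷ ys) eq with () ← eq z<s
!?≡⇒take≡take (suc ℓ) (x ∷ xs) []       eq with () ← eq z<s
!?≡⇒take≡take (suc ℓ) (x ∷ xs) (y ∷ ys) eq with refl ← eq z<s =
  cong (x ∷_) (!?≡⇒take≡take ℓ xs ys (eq ∘ s<s))

any-upTo⁻ : ∀ (p : ℕ → Bool) s → T (any p (upTo s)) → ∃[ x ] x < s × T (p x)
any-upTo⁻ p s h with x , x∈ , px ← find (any⁻ p (upTo s) h) = x , ∈-upTo⁻ x∈ , px

any-upTo⁺ : ∀ (p : ℕ → Bool) {s x} → x < s → T (p x) → T (any p (upTo s))
any-upTo⁺ p x<s px = any⁺ p (lose (∈-upTo⁺ x<s) px)

lookup-injective : ∀ {xs : List A} → AllPairs _≢_ xs → ∀ {i j} → lookup xs i ≡ lookup xs j → i ≡ j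
lookup-injective (_ ∷ _)      {zero}  {zero}  _  = refl
lookup-injective (x≢xs ∷ _)   {zero}  {suc j} eq = contradiction eq (All.lookup x≢xs (∈-lookup j))
lookup-injective (x≢xs ∷ _)   {suc i} {zero}  eq = contradiction (sym eq) (All.lookup x≢xs (∈-lookup i))
lookup-injective (_ ∷ xs-distinct) {suc i} {suc j} eq = cong suc (lookup-injective xs-distinct eq)

distinct-bounded⇒length≤ : ∀ {M} {xs : List ℕ} → AllPairs _≢_ xs → All (_< M) xs → length xs ≤ M
distinct-bounded⇒length≤ {xs = xs} distinct bounded = Fin.injective⇒≤ {f = index} index-injective
  where
  index : Fin (length xs) → Fin _
  index i = fromℕ< (All.lookup bounded (∈-lookup i))
  index-injective : ∀ {i j} → index i ≡ index j → i ≡ j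
  index-injective eq = lookup-injective distinct (Fin.fromℕ<-injective _ _ _ _ eq)

*+-injective : ∀ L .{{_ : NonZero L}} {x₁ x₂ d₁ d₂} → d₁ < L → d₂ < L →
               x₁ * L + d₁ ≡ x₂ * L + d₂ → x₁ ≡ x₂ × d₁ ≡ d₂
*+-injective L {x₁} {x₂} {d₁} {d₂} d₁<L d₂<L eq = x₁≡x₂ , d₁≡d₂
  where
  remainder : ∀ x d → d < L → (x * L + d) % L ≡ d
  remainder x d d<L = trans (cong (_% L) (+-comm (x * L) d)) (trans ([m+kn]%n≡m%n d x L) (m<n⇒m%n≡m d<L))
  d₁≡d₂ : d₁ ≡ d₂
  d₁≡d₂ = trans (sym (remainder x₁ d₁ d₁<L)) (trans (cong (_% L) eq) (remainder x₂ d₂ d₂<L))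
  x₁≡x₂ : x₁ ≡ x₂
  x₁≡x₂ = *-cancelʳ-≡ x₁ x₂ L (+-cancelʳ-≡ d₁ (x₁ * L) (x₂ * L) (trans eq (cong (x₂ * L +_) (sym d₁≡d₂))))

+-shift-≤ : ∀ a b {x y z} → a + x + y ≤ a + z → b + x + y ≤ b + z
+-shift-≤ a b {x} {y} {z} h = subst (_≤ b + z) (sym (+-assoc b x y))
  (+-monoʳ-≤ b (+-cancelˡ-≤ a (x + y) z (subst (_≤ a + z) (+-assoc a x y) h)))

suc-^3≤8*^3 : ∀ L → 1 ≤ L → suc L ^ 3 ≤ 8 * L ^ 3
suc-^3≤8*^3 L 1≤L = begin
  suc L ^ 3       ≤⟨ ^-monoˡ-≤ 3 (+-monoˡ-≤ L 1≤L) ⟩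
  (L + L) ^ 3     ≡⟨ double-cube L ⟩
  8 * L ^ 3       ∎
  where
  open ≤-Reasoning
  double-cube : ∀ L → (L + L) * ((L + L) * ((L + L) * 1)) ≡ 8 * (L * (L * (L * 1)))
  double-cube = solve-∀

cube-root : ∀ n → 1 ≤ n → ∃[ L ] 1 ≤ L × n ≤ L ^ 3 × L ^ 3 ≤ 8 * n
cube-root (suc zero)    _ = 1 , ≤-refl , ≤-refl , s≤s z≤n
cube-root (suc (suc n)) _ with L , 1≤L , n<L³ , L³≤8n ← cube-root (suc n) (s≤s z≤n)
  with suc (suc n) ≤? L ^ 3
... | yes n+1<L³ = L , 1≤L , n+1<L³ , ≤-trans L³≤8n (*-monoʳ-≤ 8 (n≤1+n (suc n)))
... | no  n+1≮L³ = suc L , s≤s z≤n , ≤-trans (s≤s n<L³) (^-monoˡ-< 3 (n<1+n L)) ,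
                   ≤-trans (suc-^3≤8*^3 L 1≤L) (*-monoʳ-≤ 8 (<⇒≤ (≰⇒> n+1≮L³)))

growth≤8L² : ∀ x y {L} → 1 ≤ L → y ≤ x + 4 + 4 * (L * L) → y ∸ x ≤ 8 * (L * L)
growth≤8L² x y {L} 1≤L y≤ = begin
  y ∸ x                   ≤⟨ m≤n+o⇒m∸n≤o y x (≤-trans y≤ (≤-reflexive (+-assoc x 4 _))) ⟩
  4 + 4 * (L * L)         ≤⟨ +-monoˡ-≤ (4 * (L * L)) (*-monoʳ-≤ 4 (*-mono-≤ 1≤L 1≤L)) ⟩
  4 * (L * L) + 4 * (L * L) ≡⟨ *-distribʳ-+ (L * L) 4 4 ⟨
  8 * (L * L)             ∎
  where open ≤-Reasoning

cube-bound : ∀ {d L n} → d ≤ 8 * (L * L) → L ^ 3 ≤ 8 * n → d ^ 3 ≤ 32768 * n ^ 2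
cube-bound {d} {L} {n} d≤ L³≤ = begin
  d ^ 3                  ≤⟨ ^-monoˡ-≤ 3 d≤ ⟩
  (8 * (L * L)) ^ 3      ≡⟨ regroup L ⟩
  512 * (L ^ 3) ^ 2      ≤⟨ *-monoʳ-≤ 512 (^-monoˡ-≤ 2 L³≤) ⟩
  512 * (8 * n) ^ 2      ≡⟨ scale n ⟩
  32768 * n ^ 2          ∎
  where
  open ≤-Reasoning
  regroup : ∀ L → (8 * (L * L)) * ((8 * (L * L)) * ((8 * (L * L)) * 1))
                ≡ 512 * ((L * (L * (L * 1))) * ((L * (L * (L * 1))) * 1))
  regroup = solve-∀
  scale : ∀ n → 512 * ((8 * n) * ((8 * n) * 1)) ≡ 32768 * (n * (n * 1))
  scale = solve-∀

-- T = X M Y and T' = X M' Y with |X| = i, |M| = m ≤ 1, |M'| = m' ≤ 1 and |Y| = q.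
record Edit (T T' : List A) : Set where
  field
    i m m' q   : ℕ
    m≤1        : m ≤ 1
    m'≤1       : m' ≤ 1
    length-T   : length T ≡ i + m + q
    length-T'  : length T' ≡ i + m' + q
    prefix-agrees : ∀ {x} → x < i → T' !? x ≡ T !? x
    suffix-agrees : ∀ x → T' !? (i + m' + x) ≡ T !? (i + m + x)

splice : ∀ (U : List A) i m M' → m ≤ 1 → length M' ≤ 1 → i + m ≤ length U →
         Edit U (take i U ++ M' ++ drop (i + m) U)
splice U i m M' m≤1 m'≤1 i+m≤n = record
  { i = i ; m = m ; m' = length M' ; q = length U ∸ (i + m)
  ; m≤1 = m≤1 ; m'≤1 = m'≤1
  ; length-T  = sym (m+[n∸m]≡n i+m≤n)
  ; length-T' = begin
      length T'                                           ≡⟨ length-++ (take i U) ⟩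
      length (take i U) + length (M' ++ drop (i + m) U)   ≡⟨ cong₂ _+_ length-X (length-++ M') ⟩
      i + (length M' + length (drop (i + m) U))           ≡⟨ +-assoc i (length M') _ ⟨
      i + length M' + length (drop (i + m) U)             ≡⟨ cong (i + length M' +_) (length-drop (i + m) U) ⟩
      i + length M' + (length U ∸ (i + m))                ∎
  ; prefix-agrees = λ {x} x<i →
      trans (++-!?ˡ (take i U) _ (subst (x <_) (sym length-X) x<i)) (take-!? i U x<i)
  ; suffix-agrees = λ x → begin
      T' !? (i + length M' + x)                       ≡⟨ cong (λ y → T' !? (y + length M' + x)) length-X ⟨
      T' !? (length (take i U) + length M' + x)       ≡⟨ cong (T' !?_) (+-assoc (length (take i U)) (length M') x) ⟩
      T' !? (length (take i U) + (length M' + x))     ≡⟨ ++-!?ʳ (take i U) _ (length M' + x) ⟩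
      (M' ++ drop (i + m) U) !? (length M' + x)       ≡⟨ ++-!?ʳ M' _ x ⟩
      drop (i + m) U !? x                             ≡⟨ drop-!? (i + m) U x ⟩
      U !? (i + m + x)                                ∎
  }
  where
  open ≡-Reasoning
  T' = take i U ++ M' ++ drop (i + m) U
  length-X : length (take i U) ≡ i
  length-X = trans (length-take i U) (m≤n⇒m⊓n≡m (≤-trans (m≤m+n i m) i+m≤n))

isEdit⇒Edit : ∀ {k} {T T' : List A} → IsEdit k T T' → Edit T T'
isEdit⇒Edit (substitution T i c i<n) = subst (λ d → Edit T (take i T ++ c ∷ drop d T)) (+-comm i 1)
  (splice T i 1 (c ∷ []) ≤-refl ≤-refl (subst (_≤ length T) (+-comm 1 i) i<n))
isEdit⇒Edit (insertion T i c i≤n)    = subst (λ d → Edit T (take i T ++ c ∷ drop d T)) (+-identityʳ i)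
  (splice T i 0 (c ∷ []) z≤n ≤-refl (subst (_≤ length T) (sym (+-identityʳ i)) i≤n))
isEdit⇒Edit (deletion T i i<n)       = subst (λ d → Edit T (take i T ++ drop d T)) (+-comm i 1)
  (splice T i 1 [] ≤-refl z≤n (subst (_≤ length T) (+-comm 1 i) i<n))

data Variant : Set where
  overlapping nonOverlapping : Variant

module LZ {A : Set} (_≟_ : DecidableEquality A) where

  occ : Variant → List A → ℕ → ℕ → Bool
  occ overlapping    = occOv _≟_
  occ nonOverlapping = occNo _≟_

  z : Variant → List A → ℕ
  z v U = countPhrases _≟_ (occ v) U (length U) 0

  SameFactor : List A → ℕ → ℕ → ℕ → Set
  SameFactor U p s ℓ = ∀ {j} → j < ℓ → U !? (p + j) ≡ U !? (s + j)

  Admissible : Variant → ℕ → ℕ → ℕ → Set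
  Admissible overlapping    p ℓ s = ⊤
  Admissible nonOverlapping p ℓ s = p + ℓ ≤ s

  record Source (v : Variant) (U : List A) (s ℓ : ℕ) : Set where
    constructor source
    field
      pos        : ℕ
      pos<s      : pos < s
      admissible : Admissible v pos ℓ s
      same       : SameFactor U pos s ℓ

  take≡take⇒SameFactor : ∀ U p s ℓ → take ℓ (drop p U) ≡ take ℓ (drop s U) → SameFactor U p s ℓ
  take≡take⇒SameFactor U p s ℓ eq {j} j<ℓ =
    trans (sym (drop-!? p U j)) (trans (take≡take⇒!?≡ ℓ (drop p U) (drop s U) eq j<ℓ) (drop-!? s U j))

  SameFactor⇒take≡take : ∀ U p s ℓ → SameFactor U p s ℓ → take ℓ (drop p U) ≡ take ℓ (drop s U)
  SameFactor⇒take≡take U p s ℓ same = !?≡⇒take≡take ℓ (drop p U) (drop s U)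
    λ {j} j<ℓ → trans (drop-!? p U j) (trans (same j<ℓ) (sym (drop-!? s U j)))

  occ⇒Source : ∀ v U s ℓ → T (occ v U s ℓ) → Source v U s ℓ
  occ⇒Source overlapping U s ℓ h with p , p<s , eq ← any-upTo⁻ _ s h =
    source p p<s tt (take≡take⇒SameFactor U p s ℓ (toWitness eq))
  occ⇒Source nonOverlapping U s ℓ h with p , p<s , fits∧eq ← any-upTo⁻ _ s h
    with fits , eq ← Equivalence.to T-∧ fits∧eq =
    source p p<s (≤ᵇ⇒≤ (p + ℓ) s fits) (take≡take⇒SameFactor U p s ℓ (toWitness eq))

  Source⇒occ : ∀ v {U s ℓ} → Source v U s ℓ → T (occ v U s ℓ)
  Source⇒occ overlapping {U} {s} {ℓ} (source p p<s _ same) =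
    any-upTo⁺ _ p<s (fromWitness (SameFactor⇒take≡take U p s ℓ same))
  Source⇒occ nonOverlapping {U} {s} {ℓ} (source p p<s fits same) =
    any-upTo⁺ _ p<s (Equivalence.from T-∧ (≤⇒≤ᵇ fits , fromWitness (SameFactor⇒take≡take U p s ℓ same)))

  -- Letters need not be fresh: the greedy factorisation is optimal even among these (z-optimal).
  record Phrase (v : Variant) (U : List A) (s ℓ : ℕ) : Set where
    field
      nonempty : 1 ≤ ℓ
      fits     : s + ℓ ≤ length U
      copy     : ℓ ≡ 1 ⊎ Source v U s ℓ

  data Factorization (v : Variant) (U : List A) : ℕ → ℕ → Set where
    []  : Factorization v U (length U) 0
    _∷_ : ∀ {s ℓ k} → Phrase v U s ℓ → Factorization v U (s + ℓ) k → Factorization v U s (suc k)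

  Admissible-intro : ∀ v {p ℓ s} → p + ℓ ≤ s → Admissible v p ℓ s
  Admissible-intro overlapping    _    = tt
  Admissible-intro nonOverlapping fits = fits

  Admissible-map : ∀ v {p ℓ s p' ℓ' s'} → (p + ℓ ≤ s → p' + ℓ' ≤ s') →
                   Admissible v p ℓ s → Admissible v p' ℓ' s'
  Admissible-map overlapping    _ _    = tt
  Admissible-map nonOverlapping f fits = f fits

  admissible? : ∀ v p ℓ s → Dec (Admissible v p ℓ s)
  admissible? overlapping    p ℓ s = yes tt
  admissible? nonOverlapping p ℓ s = p + ℓ ≤? s

  sameFactor? : ∀ U p s ℓ → Dec (SameFactor U p s ℓ)
  sameFactor? U p s = allUpTo? (λ j → ≡-dec-Maybe _≟_ (U !? (p + j)) (U !? (s + j)))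

  SameFactor-prefix : ∀ {U p s ℓ a} → a ≤ ℓ → SameFactor U p s ℓ → SameFactor U p s a
  SameFactor-prefix a≤ℓ same j<a = same (<-≤-trans j<a a≤ℓ)

  SameFactor-suffix : ∀ {U p s} d {r} → SameFactor U p s (d + r) → SameFactor U (p + d) (s + d) r
  SameFactor-suffix {U} {p} {s} d same {j} j<r = begin
    U !? (p + d + j)   ≡⟨ cong (U !?_) (+-assoc p d j) ⟩
    U !? (p + (d + j)) ≡⟨ same (+-monoʳ-< d j<r) ⟩
    U !? (s + (d + j)) ≡⟨ cong (U !?_) (+-assoc s d j) ⟨
    U !? (s + d + j)   ∎
    where open ≡-Reasoning

  Source-prefix : ∀ {v U s ℓ a} → a ≤ ℓ → Source v U s ℓ → Source v U s a
  Source-prefix {v} {U} {s} a≤ℓ (source p p<s adm same) =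
    source p p<s (Admissible-map v (≤-trans (+-monoʳ-≤ p a≤ℓ)) adm) (SameFactor-prefix {U} {p} {s} a≤ℓ same)

  Source-suffix : ∀ {v U s} d {r} → Source v U s (d + r) → Source v U (s + d) r
  Source-suffix {v} {U} {s} d {r} (source p p<s adm same) =
    source (p + d) (+-monoˡ-< d p<s) (Admissible-map v shift adm) (SameFactor-suffix {U} {p} {s} d same)
    where
    shift : p + (d + r) ≤ s → p + d + r ≤ s + d
    shift fits = ≤-trans (≤-reflexive (+-assoc p d r)) (≤-trans fits (m≤m+n s d))

  copy-phrase : ∀ {v U s ℓ} → 1 ≤ ℓ → s + ℓ ≤ length U → Source v U s ℓ → Phrase v U s ℓ
  copy-phrase 1≤ℓ fits src = record { nonempty = 1≤ℓ ; fits = fits ; copy = inj₂ src }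

  Phrase-prefix : ∀ {v U s ℓ a} → 1 ≤ a → a ≤ ℓ → Phrase v U s ℓ → Phrase v U s a
  Phrase-prefix {s = s} 1≤a a≤ℓ ph = record
    { nonempty = 1≤a
    ; fits     = ≤-trans (+-monoʳ-≤ s a≤ℓ) fits
    ; copy     = Sum.map (λ ℓ≡1 → ≤-antisym (≤-trans a≤ℓ (≤-reflexive ℓ≡1)) 1≤a) (Source-prefix a≤ℓ) copy
    }
    where open Phrase ph

  Phrase-suffix : ∀ {v U s} d {r} → 1 ≤ r → Phrase v U s (d + r) → Phrase v U (s + d) r
  Phrase-suffix {v} {U} {s} d {r} 1≤r ph = record
    { nonempty = 1≤r
    ; fits     = ≤-trans (≤-reflexive (+-assoc s d r)) fits
    ; copy     = suffix-copy r 1≤r copy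
    }
    where
    open Phrase ph
    suffix-copy : ∀ r → 1 ≤ r → d + r ≡ 1 ⊎ Source v U s (d + r) → r ≡ 1 ⊎ Source v U (s + d) r
    suffix-copy 1             _ _          = inj₁ refl
    suffix-copy (suc (suc r)) _ (inj₁ eq)  =
      contradiction (≤-trans (m≤n+m (suc (suc r)) d) (≤-reflexive eq)) λ { (s≤s ()) }
    suffix-copy (suc (suc r)) _ (inj₂ src) = inj₂ (Source-suffix d src)

  -- Optimality of greedy factorisations

  longest-≤ : ∀ f m → longest _≟_ f m ≤ m
  longest-≤ f zero    = z≤n
  longest-≤ f (suc m) with f (suc m)
  ... | true  = ≤-refl
  ... | false = m≤n⇒m≤1+n (longest-≤ f m)

  longest-satisfies : ∀ f m → 1 ≤ longest _≟_ f m → T (f (longest _≟_ f m))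
  longest-satisfies f (suc m) 1≤ with f (suc m) in eq
  ... | true  = subst T (sym eq) tt
  ... | false = longest-satisfies f m 1≤

  longest-maximal : ∀ f m {ℓ} → ℓ ≤ m → T (f ℓ) → ℓ ≤ longest _≟_ f m
  longest-maximal f zero    ℓ≤m _ = ℓ≤m
  longest-maximal f (suc m) {ℓ} ℓ≤m fℓ with f (suc m) in eq | ℓ ≟ℕ suc m
  ... | true  | _        = ℓ≤m
  ... | false | yes refl = contradiction (subst T eq fℓ) λ ()
  ... | false | no ℓ≢    = longest-maximal f m (s≤s⁻¹ (≤∧≢⇒< ℓ≤m ℓ≢)) fℓ

  greedyLen : Variant → List A → ℕ → ℕ
  greedyLen v = phraseLen _≟_ (occ v)

  count : Variant → List A → ℕ → ℕ → ℕ
  count v = countPhrases _≟_ (occ v)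

  1≤greedyLen : ∀ v U s → 1 ≤ greedyLen v U s
  1≤greedyLen v U s = m≤m⊔n 1 (longest _≟_ (occ v U s) (length U ∸ s))

  greedy-phrase : ∀ v U {s} → s < length U → Phrase v U s (greedyLen v U s)
  greedy-phrase v U {s} s<n
    with longest _≟_ (occ v U s) (length U ∸ s)
       | longest-≤ (occ v U s) (length U ∸ s)
       | longest-satisfies (occ v U s) (length U ∸ s)
  ... | zero  | _   | _   = record
    { nonempty = ≤-refl ; fits = subst (_≤ length U) (+-comm 1 s) s<n ; copy = inj₁ refl }
  ... | suc L | L≤n | sat = record
    { nonempty = s≤s z≤n
    ; fits     = ≤-trans (+-monoʳ-≤ s L≤n) (≤-reflexive (m+[n∸m]≡n (<⇒≤ s<n)))
    ; copy     = inj₂ (occ⇒Source v U s (suc L) (sat (s≤s z≤n)))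
    }

  greedy-longest : ∀ {v U s ℓ} → Phrase v U s ℓ → ℓ ≤ greedyLen v U s
  greedy-longest {v} {U} {s} {ℓ} ph with Phrase.copy ph
  ... | inj₁ refl = 1≤greedyLen v U s
  ... | inj₂ src  = ≤-trans (longest-maximal (occ v U s) (length U ∸ s) ℓ≤n∸s (Source⇒occ v src))
                              (m≤n⊔m 1 (longest _≟_ (occ v U s) (length U ∸ s)))
    where
    ℓ≤n∸s : ℓ ≤ length U ∸ s
    ℓ≤n∸s = m+n≤o⇒m≤o∸n ℓ (subst (_≤ length U) (+-comm s ℓ) (Phrase.fits ph))

  count-end : ∀ v U fuel {s} → length U ≤ s → count v U fuel s ≡ 0
  count-end v U zero       _   = refl
  count-end v U (suc fuel) {s} n≤s with length U ≤ᵇ s in eq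
  ... | true  = refl
  ... | false = contradiction (subst T eq (≤⇒≤ᵇ n≤s)) λ ()

  count-step : ∀ v U fuel {s} → s < length U → count v U (suc fuel) s ≡ suc (count v U fuel (s + greedyLen v U s))
  count-step v U fuel {s} s<n with length U ≤ᵇ s in eq
  ... | true  = contradiction (≤ᵇ⇒≤ (length U) s (subst T (sym eq) tt)) (<⇒≱ s<n)
  ... | false = refl

  fuel-step : ∀ v U fuel s → length U ≤ suc fuel + s → length U ≤ fuel + (s + greedyLen v U s)
  fuel-step v U fuel s n≤ = ≤-trans n≤ (begin
    suc fuel + s                ≡⟨ +-suc fuel s ⟨
    fuel + suc s                ≡⟨ cong (fuel +_) (+-comm 1 s) ⟩
    fuel + (s + 1)              ≤⟨ +-monoʳ-≤ fuel (+-monoʳ-≤ s (1≤greedyLen v U s)) ⟩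
    fuel + (s + greedyLen v U s) ∎)
    where open ≤-Reasoning

  count-factorization : ∀ v U fuel {s} → s ≤ length U → length U ≤ fuel + s →
                        Factorization v U s (count v U fuel s)
  count-factorization v U zero {s} s≤n n≤s = subst (λ x → Factorization v U x 0) (≤-antisym n≤s s≤n) []
  count-factorization v U (suc fuel) {s} s≤n n≤ with s <? length U
  ... | no  s≮n rewrite count-end v U (suc fuel) (≮⇒≥ s≮n) =
    subst (λ x → Factorization v U x 0) (≤-antisym (≮⇒≥ s≮n) s≤n) []
  ... | yes s<n rewrite count-step v U fuel s<n =
    greedy-phrase v U s<n ∷ count-factorization v U fuel (Phrase.fits (greedy-phrase v U s<n)) (fuel-step v U fuel s n≤)

  greedy-reaches : ∀ {v U w ℓ g} → w ≤ g → g < w + ℓ → Phrase v U w ℓ → w + ℓ ≤ g + greedyLen v U g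
  greedy-reaches {v} {U} {w} {ℓ} w≤g g<w+ℓ ph
    with d , refl ← m≤n⇒∃[o]m+o≡n w≤g
    with r , refl ← m≤n⇒∃[o]m+o≡n (+-cancelˡ-< w d ℓ g<w+ℓ) = begin
      w + (suc d + r)             ≡⟨ cong (w +_) (+-suc d r) ⟨
      w + (d + suc r)             ≡⟨ +-assoc w d (suc r) ⟨
      w + d + suc r               ≤⟨ +-monoʳ-≤ (w + d) (greedy-longest suffix) ⟩
      w + d + greedyLen v U (w + d) ∎
    where
    open ≤-Reasoning
    suffix : Phrase v U (w + d) (suc r)
    suffix = Phrase-suffix d (s≤s z≤n) (subst (Phrase v U w) (sym (+-suc d r)) ph)

  count-optimal : ∀ v U fuel {w g k} → Factorization v U w k → w ≤ g → length U ≤ fuel + g →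
                  count v U fuel g ≤ k
  count-optimal v U zero       _  _ _ = z≤n
  count-optimal v U (suc fuel) [] n≤g _ = ≤-reflexive (count-end v U (suc fuel) n≤g)
  count-optimal v U (suc fuel) {w} {g} (_∷_ {ℓ = ℓ} ph rest) w≤g n≤ with w + ℓ ≤? g
  ... | yes w+ℓ≤g = m≤n⇒m≤1+n (count-optimal v U (suc fuel) rest w+ℓ≤g n≤)
  ... | no  w+ℓ≰g rewrite count-step v U fuel (<-≤-trans (≰⇒> w+ℓ≰g) (Phrase.fits ph)) =
    s≤s (count-optimal v U fuel rest (greedy-reaches w≤g (≰⇒> w+ℓ≰g) ph) (fuel-step v U fuel g n≤))

  z-factorization : ∀ v U → Factorization v U 0 (z v U)
  z-factorization v U = count-factorization v U (length U) z≤n (≤-reflexive (sym (+-identityʳ _)))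

  z-optimal : ∀ v U {k} → Factorization v U 0 k → z v U ≤ k
  z-optimal v U fact = count-optimal v U (length U) fact z≤n (≤-reflexive (sym (+-identityʳ _)))

  -- U[s .. e) can be put in front of any factorisation of U[e ..] with at most c extra phrases.
  Cover : Variant → List A → ℕ → ℕ → ℕ → Set
  Cover v U s e c = ∀ {k} → Factorization v U e k → ∃[ k' ] k' ≤ c + k × Factorization v U s k'

  cover-++ : ∀ {v U s e f c₁ c₂} → Cover v U s e c₁ → Cover v U e f c₂ → Cover v U s f (c₁ + c₂)
  cover-++ {c₁ = c₁} {c₂} cover₁ cover₂ fact
    with k₂ , k₂≤ , fact₂ ← cover₂ fact
    with k₁ , k₁≤ , fact₁ ← cover₁ fact₂ =
    k₁ , ≤-trans k₁≤ (≤-trans (+-monoʳ-≤ c₁ k₂≤) (≤-reflexive (sym (+-assoc c₁ c₂ _)))) , fact₁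

  cover-mono : ∀ {v U s e c c'} → c ≤ c' → Cover v U s e c → Cover v U s e c'
  cover-mono c≤c' cover fact with k , k≤ , fact' ← cover fact = k , ≤-trans k≤ (+-monoˡ-≤ _ c≤c') , fact'

  cover-phrase : ∀ {v U} s x → (1 ≤ x → Phrase v U s x) → Cover v U s (s + x) 1
  cover-phrase {v} {U} s zero    _  fact = _ , n≤1+n _ , subst (λ y → Factorization v U y _) (+-identityʳ s) fact
  cover-phrase         s (suc x) ph fact = _ , ≤-refl , ph (s≤s z≤n) ∷ fact

  -- Transporting a factorisation across an edit

  module Transfer (v : Variant) {T T' : List A} (e : Edit T T') where
    open Edit e

    i≤length-T' : i ≤ length T'
    i≤length-T' = subst (i ≤_) (sym length-T') (≤-trans (m≤m+n i m') (m≤m+n (i + m') q))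

    fits-after : ∀ t ℓ → i + m + t + ℓ ≤ length T → i + m' + t + ℓ ≤ length T'
    fits-after t ℓ fits = subst (i + m' + t + ℓ ≤_) (sym length-T')
      (+-shift-≤ (i + m) (i + m') (subst (i + m + t + ℓ ≤_) length-T fits))

    Aligned : ℕ → ℕ → ℕ → Set
    Aligned x x' ℓ = ∀ {j} → j < ℓ → T' !? (x' + j) ≡ T !? (x + j)

    aligned-before : ∀ {x ℓ} → x + ℓ ≤ i → Aligned x x ℓ
    aligned-before {x} x+ℓ≤i j<ℓ = prefix-agrees (<-≤-trans (+-monoʳ-< x j<ℓ) x+ℓ≤i)

    aligned-after : ∀ t {ℓ} → Aligned (i + m + t) (i + m' + t) ℓ
    aligned-after t {j = j} _ = begin
      T' !? (i + m' + t + j)    ≡⟨ cong (T' !?_) (+-assoc (i + m') t j) ⟩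
      T' !? (i + m' + (t + j))  ≡⟨ suffix-agrees (t + j) ⟩
      T !? (i + m + (t + j))    ≡⟨ cong (T !?_) (+-assoc (i + m) t j) ⟨
      T !? (i + m + t + j)      ∎
      where open ≡-Reasoning

    SameFactor-transfer : ∀ {p p' s s' ℓ} → Aligned p p' ℓ → Aligned s s' ℓ →
                          SameFactor T p s ℓ → SameFactor T' p' s' ℓ
    SameFactor-transfer ap as same j<ℓ = trans (ap j<ℓ) (trans (same j<ℓ) (sym (as j<ℓ)))

    Source-before : ∀ {s ℓ} → s + ℓ ≤ i → Source v T s ℓ → Source v T' s ℓ
    Source-before {s} {ℓ} s+ℓ≤i (source p p<s adm same) =
      source p p<s adm (SameFactor-transfer {p} {p} {s} {s} {ℓ}
        (aligned-before (≤-trans (+-monoˡ-≤ ℓ (<⇒≤ p<s)) s+ℓ≤i)) (aligned-before s+ℓ≤i) same)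

    phrase-before : ∀ {s ℓ} → s + ℓ ≤ i → Phrase v T s ℓ → Phrase v T' s ℓ
    phrase-before s+ℓ≤i ph = record
      { nonempty = nonempty
      ; fits     = ≤-trans s+ℓ≤i i≤length-T'
      ; copy     = Sum.map₂ (Source-before s+ℓ≤i) copy
      }
      where open Phrase ph

    Avoids : ℕ → ℕ → Set
    Avoids u ℓ = u + ℓ ≤ i ⊎ i + m ≤ u

    AvoidingSource : ℕ → ℕ → Set
    AvoidingSource s ℓ = Σ (Source v T s ℓ) λ src → Avoids (Source.pos src) ℓ

    avoidingSource? : ∀ s ℓ → Dec (AvoidingSource s ℓ)
    avoidingSource? s ℓ = map′ (λ (u , u<s , adm , same , avoids) → source u u<s adm same , avoids)
                               (λ (source u u<s adm same , avoids) → u , u<s , adm , (λ {j} → same {j}) , avoids)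
      (anyUpTo? (λ u → admissible? v u ℓ s ×-dec sameFactor? T u s ℓ ×-dec (u + ℓ ≤? i ⊎-dec i + m ≤? u)) s)

    Source-after : ∀ t {ℓ} → 1 ≤ ℓ → AvoidingSource (i + m + t) ℓ → Source v T' (i + m' + t) ℓ
    Source-after t {ℓ} 1≤ℓ (source u u<s adm same , inj₁ u+ℓ≤i) =
      source u (<-≤-trans (m<m+n u 1≤ℓ) u+ℓ≤s') (Admissible-intro v u+ℓ≤s')
        (SameFactor-transfer {u} {u} {i + m + t} {i + m' + t} {ℓ} (aligned-before u+ℓ≤i) (aligned-after t) same)
      where
      u+ℓ≤s' : u + ℓ ≤ i + m' + t
      u+ℓ≤s' = ≤-trans u+ℓ≤i (≤-trans (m≤m+n i m') (m≤m+n (i + m') t))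
    Source-after t {ℓ} 1≤ℓ (source u u<s adm same , inj₂ i+m≤u)
      with w , refl ← m≤n⇒∃[o]m+o≡n i+m≤u =
      source (i + m' + w) (+-monoʳ-< (i + m') (+-cancelˡ-< (i + m) w t u<s))
        (Admissible-map v (+-shift-≤ (i + m) (i + m')) adm)
        (SameFactor-transfer {i + m + w} {i + m' + w} {i + m + t} {i + m' + t} {ℓ}
          (aligned-after w) (aligned-after t) same)

    edit-split : ∀ {w ℓ} → w ≤ i → i < w + ℓ → ∃[ a ] ∃[ r ] w + a ≡ i × a < ℓ × a + m + r ≡ ℓ
    edit-split {w} {ℓ} w≤i i<w+ℓ = a , ℓ ∸ (a + m) , w+a≡i , a<ℓ , m+[n∸m]≡n a+m≤ℓ
      where
      a = i ∸ w
      w+a≡i : w + a ≡ i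
      w+a≡i = m+[n∸m]≡n w≤i
      a<ℓ : a < ℓ
      a<ℓ = +-cancelˡ-< w a ℓ (subst (_< w + ℓ) (sym w+a≡i) i<w+ℓ)
      a+m≤ℓ : a + m ≤ ℓ
      a+m≤ℓ = ≤-trans (+-monoʳ-≤ a m≤1) (subst (_≤ ℓ) (+-comm 1 a) a<ℓ)

    unavoidable⇒straddles : ∀ {s ℓ} → ¬ AvoidingSource s ℓ → (src : Source v T s ℓ) →
                            Source.pos src ≤ i × i < Source.pos src + ℓ
    unavoidable⇒straddles {ℓ = ℓ} unavoidable src@(source p _ _ _) = p≤i , i<p+ℓ
      where
      p≤i : p ≤ i
      p≤i = s≤s⁻¹ (≤-trans (≰⇒> λ i+m≤p → unavoidable (src , inj₂ i+m≤p))
                          (subst (i + m ≤_) (+-comm i 1) (+-monoʳ-≤ i m≤1)))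
      i<p+ℓ : i < p + ℓ
      i<p+ℓ = ≰⇒> λ p+ℓ≤i → unavoidable (src , inj₁ p+ℓ≤i)

    -- The prefix of the copy up to the edit keeps its source, and the suffix after it is
    -- copied from just behind the edit; both sources avoid the edited letters.
    split-cover : ∀ t {a r} → i + m + t + (a + m + r) ≤ length T → (src : Source v T (i + m + t) (a + m + r)) →
                  Source.pos src + a ≡ i → Cover v T' (i + m' + t) (i + m' + t + (a + m + r)) 3
    split-cover t {a} {r} fits src@(source p _ _ _) p+a≡i =
      subst (λ e → Cover v T' s' e 3) (reassoc s' a m r) (cover-++ left (cover-++ middle right))
      where
      s' = i + m' + t
      fits' : s' + (a + m + r) ≤ length T'
      fits' = fits-after t (a + m + r) fits
      reassoc : ∀ x a m r → x + a + m + r ≡ x + (a + m + r)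
      reassoc = solve-∀
      left : Cover v T' s' (s' + a) 1
      left = cover-phrase s' a λ 1≤a → copy-phrase 1≤a (≤-trans (+-monoʳ-≤ s' a≤ℓ) fits')
        (Source-after t 1≤a (Source-prefix a≤ℓ src , inj₁ (≤-reflexive p+a≡i)))
        where
        a≤ℓ : a ≤ a + m + r
        a≤ℓ = ≤-trans (m≤m+n a m) (m≤m+n (a + m) r)
      middle : Cover v T' (s' + a) (s' + a + m) 1
      middle = cover-phrase (s' + a) m λ 1≤m → record
        { nonempty = 1≤m
        ; fits     = ≤-trans (≤-reflexive (+-assoc s' a m)) (≤-trans (+-monoʳ-≤ s' (m≤m+n (a + m) r)) fits')
        ; copy     = inj₁ (≤-antisym m≤1 1≤m)
        }
      position : i + m' + (t + (a + m)) ≡ s' + a + m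
      position = trans (sym (+-assoc (i + m') t (a + m))) (sym (+-assoc s' a m))
      right : Cover v T' (s' + a + m) (s' + a + m + r) 1
      right = cover-phrase (s' + a + m) r λ 1≤r →
        subst (λ x → Phrase v T' x r) position
          (copy-phrase 1≤r (subst (_≤ length T') (sym (trans (cong (_+ r) position) (reassoc s' a m r))) fits')
            (Source-after (t + (a + m)) 1≤r (subst (λ x → AvoidingSource x r) (+-assoc (i + m) t (a + m))
              (Source-suffix (a + m) src , inj₂ (≤-reflexive (trans (cong (_+ m) (sym p+a≡i)) (+-assoc p a m)))))))

    record Bad (s ℓ : ℕ) : Set where
      field
        src offset   : ℕ
        src+offset≡i : src + offset ≡ i
        offset<ℓ     : offset < ℓ
        same         : SameFactor T src s ℓ
        unavoidable  : ¬ AvoidingSource s ℓ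

    straddling : ∀ t {ℓ} → i + m + t + ℓ ≤ length T → Source v T (i + m + t) ℓ →
                 ¬ AvoidingSource (i + m + t) ℓ → Bad (i + m + t) ℓ × Cover v T' (i + m' + t) (i + m' + t + ℓ) 3
    straddling t fits src unavoidable
      with p≤i , i<p+ℓ ← unavoidable⇒straddles unavoidable src
      with a , r , p+a≡i , a<ℓ , refl ← edit-split p≤i i<p+ℓ =
      record { src = Source.pos src ; offset = a ; src+offset≡i = p+a≡i ; offset<ℓ = a<ℓ
             ; same = Source.same src ; unavoidable = unavoidable } ,
      split-cover t {a} {r} fits src p+a≡i

    after-edit : ∀ t {ℓ} → Phrase v T (i + m + t) ℓ →
                 Phrase v T' (i + m' + t) ℓ ⊎ Bad (i + m + t) ℓ × Cover v T' (i + m' + t) (i + m' + t + ℓ) 3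
    after-edit t {ℓ} ph with avoidingSource? (i + m + t) ℓ | Phrase.copy ph
    ... | yes avoiding    | _         =
      inj₁ (copy-phrase nonempty (fits-after t ℓ fits) (Source-after t nonempty avoiding))
      where open Phrase ph
    ... | no  _           | inj₁ ℓ≡1  =
      inj₁ record { nonempty = nonempty ; fits = fits-after t ℓ fits ; copy = inj₁ ℓ≡1 }
      where open Phrase ph
    ... | no  unavoidable | inj₂ src  = inj₂ (straddling t (Phrase.fits ph) src unavoidable)

    after-edit-cover : ∀ t r → (1 ≤ r → Phrase v T (i + m + t) r) → Cover v T' (i + m' + t) (i + m' + t + r) 3
    after-edit-cover t zero    _  = cover-mono (s≤s z≤n) (cover-phrase _ 0 λ ())
    after-edit-cover t (suc r) ph with after-edit t (ph (s≤s z≤n))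
    ... | inj₁ ph'          = cover-mono (s≤s z≤n) (cover-phrase _ (suc r) λ _ → ph')
    ... | inj₂ (_ , cover)  = cover

    data BadList (lo : ℕ) : ℕ → Set where
      []  : BadList lo 0
      bad : ∀ {c} s ℓ → lo ≤ s → i + m ≤ s → s + ℓ ≤ length T → Bad s ℓ →
            BadList (s + ℓ) c → BadList lo (suc c)

    BadList-weaken : ∀ {lo lo' c} → lo' ≤ lo → BadList lo c → BadList lo' c
    BadList-weaken _     []                                   = []
    BadList-weaken lo'≤lo (bad s ℓ lo≤s i+m≤s fits b rest) = bad s ℓ (≤-trans lo'≤lo lo≤s) i+m≤s fits b rest

    transfer-after : ∀ t {s k} → s ≡ i + m + t → Factorization v T s k →
                     ∃[ k' ] ∃[ c ] k' ≤ k + 2 * c × Factorization v T' (i + m' + t) k' × BadList s c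
    transfer-after t eq [] = 0 , 0 , z≤n , subst (λ x → Factorization v T' x 0) end [] , []
      where
      end : length T' ≡ i + m' + t
      end = trans length-T' (cong (i + m' +_) (+-cancelˡ-≡ (i + m) q t (trans (sym length-T) eq)))
    transfer-after t {s} {suc k} refl (_∷_ {ℓ = ℓ} ph rest)
      with k₁ , c₁ , k₁≤ , fact₁ , bads₁ ← transfer-after (t + ℓ) (+-assoc (i + m) t ℓ) rest
      with fact₁' ← subst (λ x → Factorization v T' x k₁) (sym (+-assoc (i + m') t ℓ)) fact₁
      with after-edit t ph
    ... | inj₁ ph' = suc k₁ , c₁ , s≤s k₁≤ , ph' ∷ fact₁' , BadList-weaken (m≤m+n s ℓ) bads₁
    ... | inj₂ (b , cover) with k₂ , k₂≤ , fact₂ ← cover fact₁' =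
      k₂ , suc c₁ , ≤-trans k₂≤ (≤-trans (+-monoʳ-≤ 3 k₁≤) (≤-reflexive (arith k c₁))) , fact₂ ,
      bad s ℓ ≤-refl (m≤m+n (i + m) t) (Phrase.fits ph) b bads₁
      where
      arith : ∀ k c → 3 + (k + 2 * c) ≡ suc k + 2 * suc c
      arith = solve-∀

    edit-cover : Cover v T' i (i + m') 1
    edit-cover = cover-phrase i m' λ 1≤m' → record
      { nonempty = 1≤m'
      ; fits     = subst (i + m' ≤_) (sym length-T') (m≤m+n (i + m') q)
      ; copy     = inj₁ (≤-antisym m'≤1 1≤m')
      }

    crossing : ∀ {s ℓ} → s ≤ i → i < s + ℓ → Phrase v T s ℓ →
               ∃[ r ] s + ℓ ≡ i + m + r × Cover v T' s (i + m' + r) 5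
    crossing {s} s≤i i<s+ℓ ph with a , r , s+a≡i , a<ℓ , refl ← edit-split s≤i i<s+ℓ =
      r , s+ℓ≡i+m+r , cover-++ prefix (cover-++ edit-cover remainder)
      where
      s+ℓ≡i+m+r : s + (a + m + r) ≡ i + m + r
      s+ℓ≡i+m+r = trans (reassoc s a m r) (cong (λ x → x + m + r) s+a≡i)
        where
        reassoc : ∀ x a m r → x + (a + m + r) ≡ x + a + m + r
        reassoc = solve-∀
      prefix : Cover v T' s i 1
      prefix = subst (λ x → Cover v T' s x 1) s+a≡i (cover-phrase s a λ 1≤a →
        phrase-before (≤-reflexive s+a≡i) (Phrase-prefix 1≤a (<⇒≤ a<ℓ) ph))
      remainder : Cover v T' (i + m') (i + m' + r) 3
      remainder = subst₂ (λ x y → Cover v T' x y 3) (+-identityʳ (i + m')) (cong (_+ r) (+-identityʳ (i + m')))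
        (after-edit-cover 0 r λ 1≤r → subst (λ x → Phrase v T x r) position (Phrase-suffix (a + m) 1≤r ph))
        where
        position : s + (a + m) ≡ i + m + 0
        position = trans (sym (+-assoc s a m)) (trans (cong (_+ m) s+a≡i) (sym (+-identityʳ (i + m))))

    edit-at-end : length T ≤ i → ∃[ k ] k ≤ 1 × Factorization v T' (length T) k
    edit-at-end n≤i = subst (λ x → ∃[ k ] k ≤ 1 × Factorization v T' x k) (sym length-T≡i)
      (edit-cover (subst (λ x → Factorization v T' x 0) length-T'≡i+m' []))
      where
      m+q≡0 : m + q ≡ 0
      m+q≡0 = n≤0⇒n≡0 (+-cancelˡ-≤ i (m + q) 0
        (subst₂ _≤_ (trans length-T (+-assoc i m q)) (sym (+-identityʳ i)) n≤i))
      length-T≡i : length T ≡ i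
      length-T≡i = trans length-T (trans (+-assoc i m q) (trans (cong (i +_) m+q≡0) (+-identityʳ i)))
      length-T'≡i+m' : length T' ≡ i + m'
      length-T'≡i+m' = trans length-T' (trans (cong (i + m' +_) (m+n≡0⇒n≡0 m m+q≡0)) (+-identityʳ (i + m')))

    transfer-before : ∀ {s k} → s ≤ i → Factorization v T s k →
                      ∃[ k' ] ∃[ c ] k' ≤ k + 4 + 2 * c × Factorization v T' s k' × BadList 0 c
    transfer-before n≤i [] with k' , k'≤1 , fact ← edit-at-end n≤i =
      k' , 0 , ≤-trans k'≤1 (s≤s z≤n) , fact , []
    transfer-before {s} {suc k} s≤i (_∷_ {ℓ = ℓ} ph rest) with s + ℓ ≤? i
    ... | yes s+ℓ≤i with k₁ , c₁ , k₁≤ , fact₁ , bads₁ ← transfer-before s+ℓ≤i rest =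
      suc k₁ , c₁ , s≤s k₁≤ , phrase-before s+ℓ≤i ph ∷ fact₁ , bads₁
    ... | no  s+ℓ≰i
      with r , s+ℓ≡i+m+r , cover ← crossing s≤i (≰⇒> s+ℓ≰i) ph
      with k₁ , c₁ , k₁≤ , fact₁ , bads₁ ← transfer-after r s+ℓ≡i+m+r rest
      with k₂ , k₂≤ , fact₂ ← cover fact₁ =
      k₂ , c₁ , ≤-trans k₂≤ (≤-trans (+-monoʳ-≤ 5 k₁≤) (≤-reflexive (arith k c₁))) , fact₂ ,
      BadList-weaken z≤n bads₁
      where
      arith : ∀ k c → 5 + (k + 2 * c) ≡ suc k + 4 + 2 * c
      arith = solve-∀

    -- Counting bad phrases

    code : ∀ L {s ℓ} → Bad s ℓ → ℕ
    code L {ℓ = ℓ} b = ℓ * L + Bad.offset b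

    long-count : ℕ → ∀ {lo c} → BadList lo c → ℕ
    long-count L []                        = 0
    long-count L (bad s ℓ _ _ _ _ rest) with L ≤? ℓ
    ... | yes _ = suc (long-count L rest)
    ... | no  _ = long-count L rest

    short-codes : ℕ → ∀ {lo c} → BadList lo c → List ℕ
    short-codes L []                        = []
    short-codes L (bad s ℓ _ _ _ b rest) with L ≤? ℓ
    ... | yes _ = short-codes L rest
    ... | no  _ = code L b ∷ short-codes L rest

    BadList-split : ∀ L {lo c} (bads : BadList lo c) → c ≤ long-count L bads + length (short-codes L bads)
    BadList-split L []                        = z≤n
    BadList-split L (bad s ℓ _ _ _ _ rest) with L ≤? ℓ
    ... | yes _ = s≤s (BadList-split L rest)
    ... | no  _ = ≤-trans (s≤s (BadList-split L rest)) (≤-reflexive (sym (+-suc _ _)))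

    long-count-bound : ∀ L {lo c} (bads : BadList lo c) → lo ≤ length T → lo + L * long-count L bads ≤ length T
    long-count-bound L {lo} [] lo≤n =
      subst (_≤ length T) (sym (trans (cong (lo +_) (*-zeroʳ L)) (+-identityʳ lo))) lo≤n
    long-count-bound L {lo} (bad s ℓ lo≤s _ s+ℓ≤n _ rest) _ with L ≤? ℓ | long-count-bound L rest s+ℓ≤n
    ... | yes L≤ℓ | bound = begin
      lo + L * suc (long-count L rest)   ≡⟨ cong (lo +_) (*-suc L _) ⟩
      lo + (L + L * long-count L rest)   ≡⟨ +-assoc lo L _ ⟨
      lo + L + L * long-count L rest     ≤⟨ +-monoˡ-≤ _ (+-mono-≤ lo≤s L≤ℓ) ⟩
      s + ℓ + L * long-count L rest      ≤⟨ bound ⟩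
      length T                           ∎
      where open ≤-Reasoning
    ... | no  _   | bound = ≤-trans (+-monoˡ-≤ _ (≤-trans lo≤s (m≤m+n s ℓ))) bound

    code<L*L : ∀ L {s ℓ} (b : Bad s ℓ) → ℓ < L → code L b < L * L
    code<L*L L {ℓ = ℓ} b ℓ<L = begin-strict
      ℓ * L + Bad.offset b   <⟨ +-monoʳ-< (ℓ * L) (<-trans (Bad.offset<ℓ b) ℓ<L) ⟩
      ℓ * L + L              ≡⟨ +-comm (ℓ * L) L ⟩
      suc ℓ * L              ≤⟨ *-monoˡ-≤ L ℓ<L ⟩
      L * L                  ∎
      where open ≤-Reasoning

    short-codes-bounded : ∀ L {lo c} (bads : BadList lo c) → All (_< L * L) (short-codes L bads)
    short-codes-bounded L []                        = []
    short-codes-bounded L (bad s ℓ _ _ _ b rest) with L ≤? ℓ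
    ... | yes _   = short-codes-bounded L rest
    ... | no  ℓ≱L = code<L*L L b (≰⇒> ℓ≱L) ∷ short-codes-bounded L rest

    -- Equal offsets give a common source, so the earlier phrase would be an avoiding source
    -- of the later one.
    bad-offsets-differ : ∀ {s₁ s₂ ℓ} (b₁ : Bad s₁ ℓ) (b₂ : Bad s₂ ℓ) → i + m ≤ s₁ → s₁ + ℓ ≤ s₂ →
                        Bad.offset b₁ ≢ Bad.offset b₂
    bad-offsets-differ {s₁} {s₂} {ℓ} b₁ b₂ i+m≤s₁ s₁+ℓ≤s₂ offsets =
      Bad.unavoidable b₂ (source s₁ (<-≤-trans (m<m+n s₁ (≤-<-trans z≤n (Bad.offset<ℓ b₁))) s₁+ℓ≤s₂)
                                 (Admissible-intro v s₁+ℓ≤s₂) repeat , inj₂ i+m≤s₁)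
      where
      open Bad using (src; offset; src+offset≡i)
      srcs : src b₁ ≡ src b₂
      srcs = +-cancelʳ-≡ (offset b₁) (src b₁) (src b₂)
               (trans (src+offset≡i b₁) (trans (sym (src+offset≡i b₂)) (cong (src b₂ +_) (sym offsets))))
      repeat : SameFactor T s₁ s₂ ℓ
      repeat {j} j<ℓ = trans (sym (Bad.same b₁ j<ℓ)) (trans (cong (λ x → T !? (x + j)) srcs) (Bad.same b₂ j<ℓ))

    code-fresh : ∀ L .{{_ : NonZero L}} {s ℓ} (b : Bad s ℓ) → i + m ≤ s → ℓ < L →
                 ∀ {lo c} (bads : BadList lo c) → s + ℓ ≤ lo → All (code L b ≢_) (short-codes L bads)
    code-fresh L b i+m≤s ℓ<L []                             _ = []
    code-fresh L {ℓ = ℓ} b i+m≤s ℓ<L (bad s' ℓ' lo≤s' _ _ b' rest) s+ℓ≤lo with L ≤? ℓ'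
    ... | yes _    = code-fresh L b i+m≤s ℓ<L rest (≤-trans s+ℓ≤lo (≤-trans lo≤s' (m≤m+n s' ℓ')))
    ... | no  ℓ'≱L = differ ∷ code-fresh L b i+m≤s ℓ<L rest (≤-trans s+ℓ≤lo (≤-trans lo≤s' (m≤m+n s' ℓ')))
      where
      differ : code L b ≢ code L b'
      differ eq
        with refl , offsets ← *+-injective L {ℓ} {ℓ'} (<-trans (Bad.offset<ℓ b) ℓ<L)
                                                      (<-trans (Bad.offset<ℓ b') (≰⇒> ℓ'≱L)) eq =
        bad-offsets-differ b b' i+m≤s (≤-trans s+ℓ≤lo lo≤s') offsets

    short-codes-distinct : ∀ L .{{_ : NonZero L}} {lo c} (bads : BadList lo c) → AllPairs _≢_ (short-codes L bads)
    short-codes-distinct L []                              = []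
    short-codes-distinct L (bad s ℓ _ i+m≤s _ b rest) with L ≤? ℓ
    ... | yes _   = short-codes-distinct L rest
    ... | no  ℓ≱L = code-fresh L b i+m≤s (≰⇒> ℓ≱L) rest ≤-refl ∷ short-codes-distinct L rest

    BadList-count : ∀ L .{{_ : NonZero L}} {c} → length T ≤ L ^ 3 → BadList 0 c → c ≤ 2 * (L * L)
    BadList-count L n≤L³ bads = begin
      _                                               ≤⟨ BadList-split L bads ⟩
      long-count L bads + length (short-codes L bads) ≤⟨ +-mono-≤ long≤ short≤ ⟩
      L * L + L * L                                   ≡⟨ cong (L * L +_) (+-identityʳ (L * L)) ⟨
      2 * (L * L)                                     ∎
      where
      open ≤-Reasoning
      long≤ : long-count L bads ≤ L * L
      long≤ = *-cancelˡ-≤ L (≤-trans (long-count-bound L bads z≤n)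
                                     (≤-trans n≤L³ (≤-reflexive (cong (L *_) (cong (L *_) (*-identityʳ L))))))
      short≤ : length (short-codes L bads) ≤ L * L
      short≤ = distinct-bounded⇒length≤ (short-codes-distinct L bads) (short-codes-bounded L bads)

    z-edit : ∀ L .{{_ : NonZero L}} → length T ≤ L ^ 3 → z v T' ≤ z v T + 4 + 4 * (L * L)
    z-edit L n≤L³ with k' , c , k'≤ , fact' , bads ← transfer-before z≤n (z-factorization v T) = begin
      z v T'                          ≤⟨ z-optimal v T' fact' ⟩
      k'                              ≤⟨ k'≤ ⟩
      z v T + 4 + 2 * c               ≤⟨ +-monoʳ-≤ (z v T + 4) (*-monoʳ-≤ 2 (BadList-count L n≤L³ bads)) ⟩
      z v T + 4 + 2 * (2 * (L * L))   ≡⟨ cong (z v T + 4 +_) (*-assoc 2 2 (L * L)) ⟨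
      z v T + 4 + 4 * (L * L)         ∎
      where open ≤-Reasoning

    z-growth : 1 ≤ length T → (z v T' ∸ z v T) ^ 3 ≤ 32768 * length T ^ 2
    z-growth 1≤n =
      let L , 1≤L , n≤L³ , L³≤8n = cube-root (length T) 1≤n in
      cube-bound {z v T' ∸ z v T} {L} {length T}
        (growth≤8L² (z v T) (z v T') 1≤L (z-edit L {{>-nonZero 1≤L}} n≤L³)) L³≤8n

theorem6 : (k : EditKind) →
    ∃[ C ] ∃[ N ] (∀ {A : Set} (_≟_ : DecidableEquality A) (n : ℕ) → N ≤ n →
      (T T' : List A) → length T ≡ n → IsEdit k T T' →
        ((zSSsr _≟_ T' ∸ zSSsr _≟_ T) ^ 3 ≤ C * n ^ 2)
        × ((zSS _≟_ T' ∸ zSS _≟_ T) ^ 3 ≤ C * n ^ 2))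
theorem6 k = 32768 , 1 , λ _≟_ n 1≤n T T' → λ { refl edit →
  LZ.Transfer.z-growth _≟_ overlapping    (isEdit⇒Edit edit) 1≤n ,
  LZ.Transfer.z-growth _≟_ nonOverlapping (isEdit⇒Edit edit) 1≤n }
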